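{- $\mathbb{T}$ proves the axiom scheme of Strong Collection: for every formula $\phi$, $\forall x\in a\,\exists y\,\phi(x,y)\to\exists b\,[\forall x\in a\,\exists y\in b\,\phi(x,y)\land\forall y\in b\,\exists x\in a\,\phi(x,y)]$.
   Context: $\mathbb{T}$ is the intuitionistic set theory (language $\{\in\}$) with axioms Extensionality, Pairing, Union, Binary Intersection, the Set Induction scheme $\forall x[\forall y\in x\phi(y)\to\phi(x)]\to\forall x\phi(x)$ for all $\phi$, and $V=\mathrm{Fin}$ (every set is in bijection with some $n\in\omega$, where $\omega$ is the class of ordinals $\alpha$—transitive sets of transitive sets—such that every element of $\alpha\cup\{\alpha\}$ is $\varnothing$ or $\gamma\cup\{\gamma\}$ for an ordinal $\gamma$). -}

module Defs where

open import Data.Nat using (ℕ; zero; suc; _∸_)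
open import Data.List using (List; []; _∷_; map)
open import Data.List.Membership.Propositional using (_∈_)
open import Level using (0ℓ)
open import Relation.Unary using (Pred)

-- Syntax of first-order logic with equality in the language {∈}.
-- Variables are de Bruijn indices (ℕ); there are no function symbols,
-- so terms are just variables.

infixr 4 _⇒_
infixr 5 _∨_
infixr 6 _∧_
infix 7 _∈̇_ _≐_

data Fm : Set where
  ⊥̇   : Fm
  _∈̇_ : ℕ → ℕ → Fm
  _≐_  : ℕ → ℕ → Fm
  _∧_  : Fm → Fm → Fm
  _∨_  : Fm → Fm → Fm
  _⇒_  : Fm → Fm → Fm
  ∀̇    : Fm → Fm
  ∃̇    : Fm → Fm

¬̇_ : Fm → Fm
¬̇ φ = φ ⇒ ⊥̇

_⇔_ : Fm → Fm → Fm
φ ⇔ ψ = (φ ⇒ ψ) ∧ (ψ ⇒ φ)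

-- renaming (= substitution, since terms are variables)
ext : (ℕ → ℕ) → ℕ → ℕ
ext ρ zero    = zero
ext ρ (suc i) = suc (ρ i)

rename : (ℕ → ℕ) → Fm → Fm
rename ρ ⊥̇        = ⊥̇
rename ρ (x ∈̇ y)  = ρ x ∈̇ ρ y
rename ρ (x ≐ y)  = ρ x ≐ ρ y
rename ρ (φ ∧ ψ)  = rename ρ φ ∧ rename ρ ψ
rename ρ (φ ∨ ψ)  = rename ρ φ ∨ rename ρ ψ
rename ρ (φ ⇒ ψ)  = rename ρ φ ⇒ rename ρ ψ
rename ρ (∀̇ φ)    = ∀̇ (rename (ext ρ) φ)
rename ρ (∃̇ φ)    = ∃̇ (rename (ext ρ) φ)

shift : Fm → Fm
shift = rename suc

inst : ℕ → ℕ → ℕ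
inst t zero    = t
inst t (suc i) = i

_[_] : Fm → ℕ → Fm
φ [ t ] = rename (inst t) φ

infix 2 _∣_⊢_

data _∣_⊢_ (Ax : Pred Fm 0ℓ) : List Fm → Fm → Set where
  ax    : ∀ {Γ φ} → Ax φ → Ax ∣ Γ ⊢ φ
  hyp   : ∀ {Γ φ} → φ ∈ Γ → Ax ∣ Γ ⊢ φ
  ⊥E    : ∀ {Γ φ} → Ax ∣ Γ ⊢ ⊥̇ → Ax ∣ Γ ⊢ φ
  ∧I    : ∀ {Γ φ ψ} → Ax ∣ Γ ⊢ φ → Ax ∣ Γ ⊢ ψ → Ax ∣ Γ ⊢ φ ∧ ψ
  ∧E₁   : ∀ {Γ φ ψ} → Ax ∣ Γ ⊢ φ ∧ ψ → Ax ∣ Γ ⊢ φ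
  ∧E₂   : ∀ {Γ φ ψ} → Ax ∣ Γ ⊢ φ ∧ ψ → Ax ∣ Γ ⊢ ψ
  ∨I₁   : ∀ {Γ φ ψ} → Ax ∣ Γ ⊢ φ → Ax ∣ Γ ⊢ φ ∨ ψ
  ∨I₂   : ∀ {Γ φ ψ} → Ax ∣ Γ ⊢ ψ → Ax ∣ Γ ⊢ φ ∨ ψ
  ∨E    : ∀ {Γ φ ψ χ} → Ax ∣ Γ ⊢ φ ∨ ψ → Ax ∣ φ ∷ Γ ⊢ χ → Ax ∣ ψ ∷ Γ ⊢ χ
          → Ax ∣ Γ ⊢ χ
  ⇒I    : ∀ {Γ φ ψ} → Ax ∣ φ ∷ Γ ⊢ ψ → Ax ∣ Γ ⊢ φ ⇒ ψ
  ⇒E    : ∀ {Γ φ ψ} → Ax ∣ Γ ⊢ φ ⇒ ψ → Ax ∣ Γ ⊢ φ → Ax ∣ Γ ⊢ ψ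
  ∀I    : ∀ {Γ φ} → Ax ∣ map shift Γ ⊢ φ → Ax ∣ Γ ⊢ ∀̇ φ
  ∀E    : ∀ {Γ φ} → Ax ∣ Γ ⊢ ∀̇ φ → (t : ℕ) → Ax ∣ Γ ⊢ φ [ t ]
  ∃I    : ∀ {Γ φ} (t : ℕ) → Ax ∣ Γ ⊢ φ [ t ] → Ax ∣ Γ ⊢ ∃̇ φ
  ∃E    : ∀ {Γ φ ψ} → Ax ∣ Γ ⊢ ∃̇ φ → Ax ∣ φ ∷ map shift Γ ⊢ shift ψ
          → Ax ∣ Γ ⊢ ψ
  ≐refl : ∀ {Γ} (t : ℕ) → Ax ∣ Γ ⊢ t ≐ t
  ≐subst : ∀ {Γ} φ {s t} → Ax ∣ Γ ⊢ s ≐ t → Ax ∣ Γ ⊢ φ [ s ] → Ax ∣ Γ ⊢ φ [ t ]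

-- Builders using de Bruijn *levels*, for writing closed formulas
-- readably.  A builder at depth d produces a formula; a variable of
-- level l refers to de Bruijn index d ∸ suc l.

B : Set
B = ℕ → Fm

ix : ℕ → ℕ → ℕ
ix d l = d ∸ suc l

infixr 4 _⇒ᵇ_ _⇔ᵇ_
infixr 5 _∨ᵇ_
infixr 6 _∧ᵇ_
infix 7 _∈ᵇ_ _≐ᵇ_

_∈ᵇ_ : ℕ → ℕ → B
(x ∈ᵇ y) d = ix d x ∈̇ ix d y

_≐ᵇ_ : ℕ → ℕ → B
(x ≐ᵇ y) d = ix d x ≐ ix d y

⊥ᵇ : B
⊥ᵇ d = ⊥̇

_∧ᵇ_ _∨ᵇ_ _⇒ᵇ_ _⇔ᵇ_ : B → B → B
(φ ∧ᵇ ψ) d = φ d ∧ ψ d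
(φ ∨ᵇ ψ) d = φ d ∨ ψ d
(φ ⇒ᵇ ψ) d = φ d ⇒ ψ d
(φ ⇔ᵇ ψ) d = φ d ⇔ ψ d

¬ᵇ : B → B
¬ᵇ φ = φ ⇒ᵇ ⊥ᵇ

-- Āll (λ x → body x): the bound variable gets level d (current depth)
Āll Ēx : (ℕ → B) → B
Āll f d = ∀̇ (f d (suc d))
Ēx  f d = ∃̇ (f d (suc d))

closed : B → Fm
closed φ = φ 0

⊆ᵇ : ℕ → ℕ → B
⊆ᵇ x y = Āll λ z → z ∈ᵇ x ⇒ᵇ z ∈ᵇ y

isEmpty : ℕ → B
isEmpty x = Āll λ z → ¬ᵇ (z ∈ᵇ x)

isTrans : ℕ → B
isTrans x = Āll λ z → z ∈ᵇ x ⇒ᵇ ⊆ᵇ z x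

isOrd : ℕ → B
isOrd x = isTrans x ∧ᵇ (Āll λ z → z ∈ᵇ x ⇒ᵇ isTrans z)

isSuccOf : ℕ → ℕ → B
isSuccOf b g = Āll λ z → z ∈ᵇ b ⇔ᵇ (z ∈ᵇ g ∨ᵇ z ≐ᵇ g)

isNat : ℕ → B
isNat α = isOrd α ∧ᵇ
  (Āll λ β → (β ∈ᵇ α ∨ᵇ β ≐ᵇ α) ⇒ᵇ
     (isEmpty β ∨ᵇ (Ēx λ γ → isOrd γ ∧ᵇ isSuccOf β γ)))

isPair : ℕ → ℕ → ℕ → B
isPair p u v = Āll λ z → z ∈ᵇ p ⇔ᵇ
  ((Āll λ w → w ∈ᵇ z ⇔ᵇ w ≐ᵇ u) ∨ᵇ
   (Āll λ w → w ∈ᵇ z ⇔ᵇ (w ≐ᵇ u ∨ᵇ w ≐ᵇ v)))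

isBijection : ℕ → ℕ → ℕ → B
isBijection f x n =
  (Āll λ p → p ∈ᵇ f ⇒ᵇ (Ēx λ u → Ēx λ v → u ∈ᵇ x ∧ᵇ v ∈ᵇ n ∧ᵇ isPair p u v))
  ∧ᵇ (Āll λ u → u ∈ᵇ x ⇒ᵇ (Ēx λ v → v ∈ᵇ n ∧ᵇ (Ēx λ p → p ∈ᵇ f ∧ᵇ isPair p u v)))
  ∧ᵇ (Āll λ v → v ∈ᵇ n ⇒ᵇ (Ēx λ u → u ∈ᵇ x ∧ᵇ (Ēx λ p → p ∈ᵇ f ∧ᵇ isPair p u v)))
  ∧ᵇ (Āll λ u → Āll λ v → Āll λ v' → Āll λ p → Āll λ p' →
        (p ∈ᵇ f ∧ᵇ isPair p u v ∧ᵇ p' ∈ᵇ f ∧ᵇ isPair p' u v') ⇒ᵇ v ≐ᵇ v')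
  ∧ᵇ (Āll λ u → Āll λ u' → Āll λ v → Āll λ p → Āll λ p' →
        (p ∈ᵇ f ∧ᵇ isPair p u v ∧ᵇ p' ∈ᵇ f ∧ᵇ isPair p' u' v) ⇒ᵇ u ≐ᵇ u')

Extensionality : Fm
Extensionality = closed (Āll λ a → Āll λ b →
  (Āll λ x → x ∈ᵇ a ⇔ᵇ x ∈ᵇ b) ⇒ᵇ a ≐ᵇ b)

Pairing : Fm
Pairing = closed (Āll λ a → Āll λ b → Ēx λ c →
  Āll λ x → x ∈ᵇ c ⇔ᵇ (x ≐ᵇ a ∨ᵇ x ≐ᵇ b))

Union : Fm
Union = closed (Āll λ a → Ēx λ u →
  Āll λ x → x ∈ᵇ u ⇔ᵇ (Ēx λ y → y ∈ᵇ a ∧ᵇ x ∈ᵇ y))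

BinaryIntersection : Fm
BinaryIntersection = closed (Āll λ a → Āll λ b → Ēx λ c →
  Āll λ x → x ∈ᵇ c ⇔ᵇ (x ∈ᵇ a ∧ᵇ x ∈ᵇ b))

VeqFin : Fm
VeqFin = closed (Āll λ x → Ēx λ n → isNat n ∧ᵇ (Ēx λ f → isBijection f x n))

-- Set induction instance for φ: free variable 0 of φ is the induction
-- variable x; variables suc k of φ are parameters, which remain free
-- (as variable k) in the resulting (open) axiom.
--   ∀x[∀y∈x φ(y) → φ(x)] → ∀x φ(x)
SetInduction : Fm → Fm
SetInduction φ =
  ∀̇ (∀̇ (0 ∈̇ 1 ⇒ rename (ext suc) φ) ⇒ φ) ⇒ ∀̇ φ

data 𝕋-Ax : Pred Fm 0ℓ where
  ext-ax   : 𝕋-Ax Extensionality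
  pair-ax  : 𝕋-Ax Pairing
  union-ax : 𝕋-Ax Union
  inter-ax : 𝕋-Ax BinaryIntersection
  ind-ax   : ∀ φ → 𝕋-Ax (SetInduction φ)
  fin-ax   : 𝕋-Ax VeqFin

𝕋⊢_ : Fm → Set
𝕋⊢ φ = 𝕋-Ax ∣ [] ⊢ φ

-- Strong Collection instance for φ(x , y): variable 0 of φ is y,
-- variable 1 is x, variable (k + 2) is the k-th parameter.  In the
-- resulting open formula, variable 0 is a and variable (k + 1) is the
-- k-th parameter.
--  ∀x∈a ∃y φ(x,y) → ∃b [∀x∈a ∃y∈b φ(x,y) ∧ ∀y∈b ∃x∈a φ(x,y)]

-- context: y=0, x=1, a=2, params from 3
ρL : ℕ → ℕ
ρL zero          = 0
ρL (suc zero)    = 1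
ρL (suc (suc k)) = 3 Data.Nat.+ k

-- context: y=0, x=1, b=2, a=3, params from 4
ρR₁ : ℕ → ℕ
ρR₁ zero          = 0
ρR₁ (suc zero)    = 1
ρR₁ (suc (suc k)) = 4 Data.Nat.+ k

-- context: x=0, y=1, b=2, a=3, params from 4
ρR₂ : ℕ → ℕ
ρR₂ zero          = 1
ρR₂ (suc zero)    = 0
ρR₂ (suc (suc k)) = 4 Data.Nat.+ k

StrongCollection : Fm → Fm
StrongCollection φ =
  ∀̇ (0 ∈̇ 1 ⇒ ∃̇ (rename ρL φ))
  ⇒ ∃̇ ( ∀̇ (0 ∈̇ 2 ⇒ ∃̇ (0 ∈̇ 2 ∧ rename ρR₁ φ))
      ∧ ∀̇ (0 ∈̇ 1 ⇒ ∃̇ (0 ∈̇ 3 ∧ rename ρR₂ φ)))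

-- By V = Fin pick n ∈ ω and a bijection f : a → n.  There is no
-- Separation, so the preimage f⁻¹[m] is only a formula; by set induction on m one
-- shows, for every m ∈ n ∪ {n}, that some set b collects a φ-image of each
-- x ∈ f⁻¹[m] while consisting of φ-images of elements of a.  For m = ∅ take b = ∅.
-- For m = γ ∪ {γ}, f⁻¹[m] ⊆ f⁻¹[γ] ∪ {x₀} where f(x₀) = γ, so the set b collecting
-- f⁻¹[γ] is enlarged to b ∪ {y₀} for some y₀ with φ(x₀, y₀) (Pairing and Union).
-- At m = n the preimage is all of a.

module Submission where

open import Defs
open import Data.Nat using (ℕ; zero; suc; _+_)
open import Data.Product using (_×_; _,_; proj₁; proj₂)
open import Data.List using (_∷_; length; lookup)
open import Data.Fin using (Fin; #_)
open import Data.List.Membership.Propositional.Properties using (∈-lookup)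
open import Function using (_∘_; id)
open import Level using (0ℓ)
open import Relation.Binary.PropositionalEquality
  using (_≡_; refl; sym; trans; cong; cong₂; cong-app; subst; subst₂; _≗_)
open import Relation.Unary using (Pred)

ext-cong : ∀ {ρ ρ′} → ρ ≗ ρ′ → ext ρ ≗ ext ρ′
ext-cong e zero    = refl
ext-cong e (suc i) = cong suc (e i)

rename-cong : ∀ {ρ ρ′} → ρ ≗ ρ′ → ∀ A → rename ρ A ≡ rename ρ′ A
rename-cong e ⊥̇       = refl
rename-cong e (x ∈̇ y) = cong₂ _∈̇_ (e x) (e y)
rename-cong e (x ≐ y) = cong₂ _≐_ (e x) (e y)
rename-cong e (A ∧ B) = cong₂ _∧_ (rename-cong e A) (rename-cong e B)
rename-cong e (A ∨ B) = cong₂ _∨_ (rename-cong e A) (rename-cong e B)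
rename-cong e (A ⇒ B) = cong₂ _⇒_ (rename-cong e A) (rename-cong e B)
rename-cong e (∀̇ A)   = cong ∀̇ (rename-cong (ext-cong e) A)
rename-cong e (∃̇ A)   = cong ∃̇ (rename-cong (ext-cong e) A)

ext-∘ : ∀ ρ σ → ext ρ ∘ ext σ ≗ ext (ρ ∘ σ)
ext-∘ ρ σ zero    = refl
ext-∘ ρ σ (suc i) = refl

rename-∘ : ∀ ρ σ A → rename ρ (rename σ A) ≡ rename (ρ ∘ σ) A
rename-∘ ρ σ ⊥̇       = refl
rename-∘ ρ σ (x ∈̇ y) = refl
rename-∘ ρ σ (x ≐ y) = refl
rename-∘ ρ σ (A ∧ B) = cong₂ _∧_ (rename-∘ ρ σ A) (rename-∘ ρ σ B)
rename-∘ ρ σ (A ∨ B) = cong₂ _∨_ (rename-∘ ρ σ A) (rename-∘ ρ σ B)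
rename-∘ ρ σ (A ⇒ B) = cong₂ _⇒_ (rename-∘ ρ σ A) (rename-∘ ρ σ B)
rename-∘ ρ σ (∀̇ A)   = cong ∀̇ (trans (rename-∘ (ext ρ) (ext σ) A) (rename-cong (ext-∘ ρ σ) A))
rename-∘ ρ σ (∃̇ A)   = cong ∃̇ (trans (rename-∘ (ext ρ) (ext σ) A) (rename-cong (ext-∘ ρ σ) A))

ext-id : ext id ≗ id
ext-id zero    = refl
ext-id (suc i) = refl

rename-id : ∀ A → rename id A ≡ A
rename-id ⊥̇       = refl
rename-id (x ∈̇ y) = refl
rename-id (x ≐ y) = refl
rename-id (A ∧ B) = cong₂ _∧_ (rename-id A) (rename-id B)
rename-id (A ∨ B) = cong₂ _∨_ (rename-id A) (rename-id B)
rename-id (A ⇒ B) = cong₂ _⇒_ (rename-id A) (rename-id B)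
rename-id (∀̇ A)   = cong ∀̇ (trans (rename-cong ext-id A) (rename-id A))
rename-id (∃̇ A)   = cong ∃̇ (trans (rename-cong ext-id A) (rename-id A))

-- A renaming of φ is determined by the images of y (= 0), of x (= 1) and of the
-- parameters, so two concrete renamings of φ are compared by computing these.
split₂ : (ℕ → ℕ) → ℕ × ℕ × (ℕ → ℕ)
split₂ ρ = ρ 0 , ρ 1 , ρ ∘ suc ∘ suc

split₂-injective : ∀ {ρ ρ′} → split₂ ρ ≡ split₂ ρ′ → ρ ≗ ρ′
split₂-injective e zero          = cong proj₁ e
split₂-injective e (suc zero)    = cong (proj₁ ∘ proj₂) e
split₂-injective e (suc (suc k)) = cong-app (cong (proj₂ ∘ proj₂) e) k

-- Instance search reads off the composite renaming from a stack of renames of φ.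
record IsRenamingOf (φ A : Fm) : Set where
  field
    ren    : ℕ → ℕ
    ≡-ren : A ≡ rename ren φ

open IsRenamingOf

instance
  self-isRenamingOf : ∀ {φ} → IsRenamingOf φ φ
  self-isRenamingOf {φ} = record { ren = id ; ≡-ren = sym (rename-id φ) }

  rename-isRenamingOf : ∀ {φ A ρ} {{_ : IsRenamingOf φ A}} → IsRenamingOf φ (rename ρ A)
  rename-isRenamingOf {φ} {A} {ρ} {{R}} = record
    { ren = ρ ∘ ren R
    ; ≡-ren = trans (cong (rename ρ) (≡-ren R)) (rename-∘ ρ (ren R) φ) }

renamings-≡ : ∀ {φ A B} {{RA : IsRenamingOf φ A}} {{RB : IsRenamingOf φ B}} →
              split₂ (ren RA) ≡ split₂ (ren RB) → A ≡ B
renamings-≡ {φ} {{RA}} {{RB}} e =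
  trans (≡-ren RA) (trans (rename-cong (split₂-injective e) φ) (sym (≡-ren RB)))

module _ {Ax : Pred Fm 0ℓ} where

  hy : ∀ {Γ} (i : Fin (length Γ)) → Ax ∣ Γ ⊢ lookup Γ i
  hy i = hyp (∈-lookup i)

  cut : ∀ {Γ A B} → Ax ∣ Γ ⊢ A → Ax ∣ A ∷ Γ ⊢ B → Ax ∣ Γ ⊢ B
  cut d k = ⇒E (⇒I k) d

  infixl 5 _·_
  _·_ : ∀ {Γ A B} → Ax ∣ Γ ⊢ A ⇒ B → Ax ∣ Γ ⊢ A → Ax ∣ Γ ⊢ B
  _·_ = ⇒E

  ≐-sym : ∀ {Γ s t} → Ax ∣ Γ ⊢ s ≐ t → Ax ∣ Γ ⊢ t ≐ s
  ≐-sym {s = s} e = ≐subst (0 ≐ suc s) e (≐refl s)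

InPreimage : ℕ → ℕ → ℕ → B
InPreimage f m x = Ēx λ u → Ēx λ p → u ∈ᵇ m ∧ᵇ p ∈ᵇ f ∧ᵇ isPair p x u

Total : (ℕ → ℕ → B) → ℕ → B
Total R a = Āll λ x → x ∈ᵇ a ⇒ᵇ Ēx λ y → R x y

-- R and R′ are the same relation in use; keeping them apart lets recast₂ address
-- the two instances of φ separately.
Collects : (ℕ → ℕ → B) → (ℕ → ℕ → B) → (ℕ → B) → ℕ → B
Collects R R′ P a = Ēx λ b →
  (Āll λ x → P x ⇒ᵇ Ēx λ y → y ∈ᵇ b ∧ᵇ R x y) ∧ᵇ
  (Āll λ y → y ∈ᵇ b ⇒ᵇ Ēx λ x → x ∈ᵇ a ∧ᵇ R′ x y)

PreimageStep : ℕ → ℕ → ℕ → ℕ → B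
PreimageStep f m γ x₀ = Āll λ x → InPreimage f m x ⇒ᵇ InPreimage f γ x ∨ᵇ x ≐ᵇ x₀

Adjunction : Fm
Adjunction = closed (Āll λ b → Āll λ y → Ēx λ c →
  Āll λ z → z ∈ᵇ c ⇔ᵇ (z ∈ᵇ b ∨ᵇ z ≐ᵇ y))

leaf : Fm → ℕ → ℕ → B
leaf X _ _ _ = X

total-shape : ℕ → ℕ → Fm → Fm
total-shape a d X = Total (leaf X) a d

collects-shape : (ℕ → B) → ℕ → ℕ → Fm → Fm → Fm
collects-shape P a d X Y = Collects (leaf X) (leaf Y) P a d

-- Formulas below are builders over de Bruijn levels: a, n, f (the bijection
-- a → n), the induction variable m, its predecessor γ, then x₀ with f(x₀) = γ, and
-- either the pair p₀ = ⟨x₀, γ⟩ ∈ f or an image y₀ of x₀.  A lemma stated at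
-- depth d has the first d of them in scope.
ℓa ℓn ℓf ℓm ℓγ ℓx₀ ℓy₀ ℓp₀ : ℕ
ℓa  = 0
ℓn  = 1
ℓf  = 2
ℓm  = 3
ℓγ  = 4
ℓx₀ = 5
ℓy₀ = 6
ℓp₀ = 6

adjunction : ∀ {Γ} → 𝕋-Ax ∣ Γ ⊢ Adjunction
adjunction = ∀I (∀I
  (∃E (∀E (∀E (ax pair-ax) 0) 0)
  (∃E (∀E (∀E (ax pair-ax) 2) 0)
  (∃E (∀E (ax union-ax) 0)
  (∃I 0 (∀I (∧I
    (⇒I (∃E (∧E₁ (∀E (hy (# 1)) 0) · hy (# 0))
      (∨E (∧E₁ (∀E (hy (# 3)) 0) · ∧E₁ (hy (# 0)))
        (∨I₁ (≐subst (2 ∈̇ 0) (hy (# 0)) (∧E₂ (hy (# 1)))))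
        (∨E (∧E₁ (∀E (hy (# 5)) 1) · ≐subst (2 ∈̇ 0) (hy (# 0)) (∧E₂ (hy (# 1))))
          (∨I₂ (hy (# 0))) (∨I₂ (hy (# 0)))))))
    (⇒I (∧E₂ (∀E (hy (# 1)) 0) · ∨E (hy (# 0))
      (∃I 5 (∧I (∧E₂ (∀E (hy (# 3)) 5) · ∨I₁ (≐refl 5)) (hy (# 0))))
      (∃I 3 (∧I (∧E₂ (∀E (hy (# 3)) 3) · ∨I₂ (≐refl 3))
                (∧E₂ (∀E (hy (# 4)) 0) · ∨I₁ (hy (# 0))))))))))))))

∈-below : ∀ {Ax Γ} → Ax ∣ Γ ⊢ (isTrans ℓn ⇒ᵇ (ℓm ∈ᵇ ℓn ∨ᵇ ℓm ≐ᵇ ℓn) ⇒ᵇ ℓγ ∈ᵇ ℓm ⇒ᵇ ℓγ ∈ᵇ ℓn) 5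
∈-below = ⇒I (⇒I (⇒I (∨E (hy (# 1))
  (∀E (∀E (hy (# 3)) 1 · hy (# 0)) 0 · hy (# 1))
  (≐subst (1 ∈̇ 0) (hy (# 0)) (hy (# 1))))))

preimage-succ : ∀ {Ax Γ} → Ax ∣ Γ ⊢
  (isSuccOf ℓm ℓγ ⇒ᵇ isBijection ℓf ℓa ℓn ⇒ᵇ ℓp₀ ∈ᵇ ℓf ⇒ᵇ isPair ℓp₀ ℓx₀ ℓγ ⇒ᵇ
   PreimageStep ℓf ℓm ℓγ ℓx₀) 7
preimage-succ = ⇒I (⇒I (⇒I (⇒I (∀I (⇒I (∃E (hy (# 0)) (∃E (hy (# 0))
  (∨E (∧E₁ (∀E (hy (# 6)) 1) · ∧E₁ (hy (# 0)))
    (∨I₁ (∃I 1 (∃I 0 (∧I (hy (# 0)) (∧E₂ (hy (# 1)))))))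
    -- u = γ: f(x) = γ = f(x₀), so x = x₀ by injectivity
    (∨I₂ (∀E (∀E (∀E (∀E (∀E (∧E₂ (∧E₂ (∧E₂ (∧E₂ (hy (# 6)))))) 2) 4) 5) 0) 3
          · ∧I (∧E₁ (∧E₂ (hy (# 1))))
               (∧I (≐subst (isPair 9 7 10 11) (hy (# 0)) (∧E₂ (∧E₂ (hy (# 1)))))
                   (∧I (hy (# 5)) (hy (# 4))))))))))))))

collects-empty : ∀ {Ax Γ R R′} → Ax ∣ Γ ⊢ (isEmpty ℓm ⇒ᵇ Collects R R′ (InPreimage ℓf ℓm) ℓa) 4
collects-empty = ⇒I (∃I 0 (∧I
  (∀I (⇒I (∃E (hy (# 0)) (∃E (hy (# 0)) (⊥E (∀E (hy (# 3)) 1 · ∧E₁ (hy (# 0))))))))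
  (∀I (⇒I (⊥E (∀E (hy (# 1)) 0 · hy (# 0)))))))

module Collection (φ : Fm) where

  args : ℕ → ℕ → ℕ → ℕ → ℕ
  args x y s zero          = y
  args x y s (suc zero)    = x
  args x y s (suc (suc k)) = s + k

  -- φ(x, y) at depth d; the parameters of φ follow the d level variables, as in
  -- StrongCollection.
  φᵇ : ℕ → ℕ → B
  φᵇ x y d = rename (args (ix d x) (ix d y) d) φ

  Collectsφ : (ℕ → B) → ℕ → B
  Collectsφ = Collects φᵇ φᵇ

  recast₁ : ∀ {Ax Γ A A′} (C : Fm → Fm) {{RA : IsRenamingOf φ A}} {{RA′ : IsRenamingOf φ A′}} →
            split₂ (ren RA) ≡ split₂ (ren RA′) → Ax ∣ Γ ⊢ C A → Ax ∣ Γ ⊢ C A′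
  recast₁ C e = subst (λ X → _ ∣ _ ⊢ C X) (renamings-≡ {φ} e)

  recast₂ : ∀ {Ax Γ A A′ B B′} (C : Fm → Fm → Fm)
            {{RA : IsRenamingOf φ A}} {{RA′ : IsRenamingOf φ A′}}
            {{RB : IsRenamingOf φ B}} {{RB′ : IsRenamingOf φ B′}} →
            split₂ (ren RA) ≡ split₂ (ren RA′) → split₂ (ren RB) ≡ split₂ (ren RB′) →
            Ax ∣ Γ ⊢ C A B → Ax ∣ Γ ⊢ C A′ B′
  recast₂ C e e′ = subst₂ (λ X Y → _ ∣ _ ⊢ C X Y) (renamings-≡ {φ} e) (renamings-≡ {φ} e′)

  φ-cast : ∀ {Ax Γ A A′} {{RA : IsRenamingOf φ A}} {{RA′ : IsRenamingOf φ A′}} →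
           split₂ (ren RA) ≡ split₂ (ren RA′) → Ax ∣ Γ ⊢ A → Ax ∣ Γ ⊢ A′
  φ-cast = recast₁ id

  φᵇ-subst-x : ∀ {Ax Γ} x x′ y d → Ax ∣ Γ ⊢ (x ≐ᵇ x′) d → Ax ∣ Γ ⊢ φᵇ x y d → Ax ∣ Γ ⊢ φᵇ x′ y d
  φᵇ-subst-x x x′ y d e h =
    φ-cast refl (≐subst (rename (args 0 (suc (ix d y)) (suc d)) φ) e (φ-cast refl h))

  φᵇ-subst-y : ∀ {Ax Γ} x y y′ d → Ax ∣ Γ ⊢ (y ≐ᵇ y′) d → Ax ∣ Γ ⊢ φᵇ x y d → Ax ∣ Γ ⊢ φᵇ x y′ d
  φᵇ-subst-y x y y′ d e h =
    φ-cast refl (≐subst (rename (args (suc (ix d x)) 0 (suc d)) φ) e (φ-cast refl h))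

  collects-adjoin : ∀ {Γ} → 𝕋-Ax ∣ Γ ⊢
    (Collectsφ (InPreimage ℓf ℓγ) ℓa ⇒ᵇ PreimageStep ℓf ℓm ℓγ ℓx₀ ⇒ᵇ ℓx₀ ∈ᵇ ℓa ⇒ᵇ φᵇ ℓx₀ ℓy₀ ⇒ᵇ
     Collectsφ (InPreimage ℓf ℓm) ℓa) 7
  collects-adjoin = ⇒I (⇒I (⇒I (⇒I
    (∃E (hy (# 3)) (∃E (∀E (∀E adjunction 0) 1) (∃I 0 (∧I
      (∀I (⇒I (∨E (∀E (hy (# 5)) 0 · hy (# 0))
        (∃E (∀E (∧E₁ (hy (# 3))) 0 · hy (# 0))
          (∃I 0 (∧I (∧E₂ (∀E (hy (# 3)) 0) · ∨I₁ (∧E₁ (hy (# 0))))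
                    (φ-cast refl (∧E₂ (hy (# 0)))))))
        (∃I 3 (∧I (∧E₂ (∀E (hy (# 2)) 3) · ∨I₂ (≐refl 3))
                  (φ-cast refl (φᵇ-subst-x ℓx₀ 9 ℓy₀ 10 (≐-sym (hy (# 0))) (φ-cast refl (hy (# 4))))))))))
      (∀I (⇒I (∨E (∧E₁ (∀E (hy (# 1)) 0) · hy (# 0))
        (∃E (∀E (∧E₂ (hy (# 3))) 0 · hy (# 0))
          (∃I 0 (∧I (∧E₁ (hy (# 0))) (φ-cast refl (∧E₂ (hy (# 0)))))))
        (∃I 4 (∧I (hy (# 5))
                  (φ-cast refl (φᵇ-subst-y ℓx₀ ℓy₀ 9 10 (≐-sym (hy (# 0))) (φ-cast refl (hy (# 4)))))))))))))))))

  collects-succ : ∀ {Γ} → 𝕋-Ax ∣ Γ ⊢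
    (Total φᵇ ℓa ⇒ᵇ isBijection ℓf ℓa ℓn ⇒ᵇ ℓγ ∈ᵇ ℓn ⇒ᵇ isSuccOf ℓm ℓγ ⇒ᵇ
     Collectsφ (InPreimage ℓf ℓγ) ℓa ⇒ᵇ Collectsφ (InPreimage ℓf ℓm) ℓa) 5
  collects-succ = ⇒I (⇒I (⇒I (⇒I (⇒I
    (∃E (∀E (∧E₁ (∧E₂ (∧E₂ (hy (# 3))))) 0 · hy (# 2))
    (cut (∃E (∧E₂ (hy (# 0)))
           (preimage-succ · hy (# 3) · hy (# 5) · ∧E₁ (hy (# 0)) · ∧E₂ (hy (# 0))))
    (∃E (∀E (hy (# 6)) 0 · ∧E₁ (hy (# 1)))
    (recast₂ (collects-shape (InPreimage ℓf ℓm) ℓa 7) refl refl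
      (collects-adjoin · recast₂ (collects-shape (InPreimage ℓf ℓγ) ℓa 7) refl refl (hy (# 3))
                       · hy (# 1) · ∧E₁ (hy (# 2)) · φ-cast refl (hy (# 0)))))))))))

  collects-below : ∀ {Γ} → 𝕋-Ax ∣ Γ ⊢
    (Total φᵇ ℓa ⇒ᵇ isNat ℓn ⇒ᵇ isBijection ℓf ℓa ℓn ⇒ᵇ
     Āll λ m → (m ∈ᵇ ℓn ∨ᵇ m ≐ᵇ ℓn) ⇒ᵇ Collectsφ (InPreimage ℓf m) ℓa) 3
  collects-below = ⇒I (⇒I (⇒I (ax (ind-ax _) · ∀I (⇒I (⇒I
    (∨E (∀E (∧E₂ (hy (# 3))) 0 · hy (# 0))
      (collects-empty {R = φᵇ} {R′ = φᵇ} · hy (# 0))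
      (∃E (hy (# 0))
      (cut (∧E₂ (∀E (∧E₂ (hy (# 0))) 0) · ∨I₂ (≐refl 0))
      (cut (∈-below · ∧E₁ (∧E₁ (hy (# 6))) · hy (# 3) · hy (# 0))
      (recast₂ (collects-shape (InPreimage ℓf ℓm) ℓa 5) refl refl
        (collects-succ · recast₁ (total-shape ℓa 5) refl (hy (# 8)) · hy (# 6) · hy (# 0)
                       · ∧E₂ (hy (# 2))
                       · recast₂ (collects-shape (InPreimage ℓf ℓγ) ℓa 5) refl refl
                           (∀E (hy (# 5)) 0 · hy (# 1) · ∨I₁ (hy (# 0))))))))))))))

  collects-domain : ∀ {Ax Γ} → Ax ∣ Γ ⊢
    (isBijection ℓf ℓa ℓn ⇒ᵇ Collectsφ (InPreimage ℓf ℓn) ℓa ⇒ᵇ Collectsφ (_∈ᵇ ℓa) ℓa) 3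
  collects-domain = ⇒I (⇒I (∃E (hy (# 0)) (∃I 0 (∧I
    (∀I (⇒I
      (cut (∃E (∀E (∧E₁ (∧E₂ (hy (# 3)))) 0 · hy (# 0))
             (∃E (∧E₂ (hy (# 0))) (∃I 1 (∃I 0 (∧I (∧E₁ (hy (# 1))) (hy (# 0)))))))
      (∃E (∀E (∧E₁ (hy (# 2))) 0 · hy (# 0))
        (∃I 0 (∧I (∧E₁ (hy (# 0))) (φ-cast refl (∧E₂ (hy (# 0))))))))))
    (∀I (⇒I (∃E (∀E (∧E₂ (hy (# 1))) 0 · hy (# 0))
      (∃I 0 (∧I (∧E₁ (hy (# 0))) (φ-cast refl (∧E₂ (hy (# 0)))))))))))))

  strong-collection : ∀ {Γ} → 𝕋-Ax ∣ Γ ⊢ (Total φᵇ ℓa ⇒ᵇ Collectsφ (_∈ᵇ ℓa) ℓa) 1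
  strong-collection = ⇒I (∃E (∀E (ax fin-ax) 0) (∃E (∧E₂ (hy (# 0)))
    (recast₂ (collects-shape (_∈ᵇ ℓa) ℓa 3) refl refl
      (collects-domain · hy (# 0)
        · recast₂ (collects-shape (InPreimage ℓf ℓn) ℓa 3) refl refl
            (∀E (collects-below · recast₁ (total-shape ℓa 3) refl (hy (# 2)) · ∧E₁ (hy (# 1)) · hy (# 0)) 1
             · ∨I₂ (≐refl 1))))))

mainTheorem10 : (φ : Fm) → 𝕋⊢ StrongCollection φ
-- StrongCollection φ is strong-collection up to the renamings of φ it uses.
mainTheorem10 φ = ⇒I (recast₂ (collects-shape (_∈ᵇ ℓa) ℓa 1) refl refl
  (strong-collection · recast₁ (total-shape ℓa 1) refl (hy (# 0))))
  where open Collection φ
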